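{- Let $V$ be a finite set of variables and let $\mathcal{B}$ be a Sperner family of nonempty proper subsets of $V$ with $\bigcup_{B\in\mathcal{B}}B=V$ and $\bigcap_{B\in\mathcal{B}}B=\emptyset$. Let $\mathcal{B}=\mathcal{B}_1\cup\dots\cup\mathcal{B}_q$ be a partition of $\mathcal{B}$ with $q\ge 2$, and let $B_i\in\mathcal{B}_i$ for $i=1,\dots,q$. Then for each measure $*\in\{B,BA,TA,C,BC,L\}$, $$OPT_*(\mathcal{B})\ge\sum_{i=1}^q\min\{\mathrm{price}_*(B_i,B)\mid B\in\mathcal{B}\setminus\mathcal{B}_i\}.$$
   Context: A pure Horn clause $B\rightarrow v$, with $\emptyset\neq B\subseteq V$ and $v\in V\setminus B$, is the clause $v\vee\bigvee_{u\in B}\overline{u}$. For $H\subseteq V\setminus B$, $B\rightarrow H$ abbreviates $\bigwedge_{v\in H}B\rightarrow v$. A pure Horn CNF grouped by bodies is written $\Phi=\bigwedge_{i=1}^{r}B_i\rightarrow H_i$ with distinct bodies $B_i$ and nonempty $H_i$; $\mathcal{B}_\Phi=\{B_1,\dots,B_r\}$. Measures: $|\Phi|_B=r$, $|\Phi|_{BA}=\sum_i|B_i|$, $|\Phi|_{TA}=\sum_i(|B_i|+|H_i|)$, $|\Phi|_C=\sum_i|H_i|$, $|\Phi|_{BC}=\sum_i(|H_i|+1)$, $|\Phi|_L=\sum_i(|B_i|+1)|H_i|$. The key Horn function $h_{\mathcal{B}}$ is represented by $\bigwedge_{B\in\mathcal{B}}B\rightarrow(V\setminus B)$; a representation is any equivalent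 pure Horn CNF and $OPT_*(\mathcal{B})$ is the minimum of $|\cdot|_*$ over representations. For $Z\subseteq V$, the closure $F_\Phi(Z)$ is the smallest superset of $Z$ whose characteristic vector satisfies $\Phi$ (obtained by forward chaining). For $S,T\subseteq V$, $\mathrm{price}_*(S,T)=\min\{|\Phi|_*:\Phi$ pure Horn CNF, $\mathcal{B}_\Phi\subseteq\mathcal{B}$, $T\subseteq F_\Phi(S)\}$. Sperner means no member of $\mathcal{B}$ is a proper subset of another. -}

module Defs where

open import Data.Nat using (ℕ; suc; _+_; _*_; _≤_)
open import Data.Fin using (Fin)
open import Data.Fin.Subset using (Subset; _⊆_; _∈_; _∉_; ∁; _∩_; ∣_∣; Nonempty; Empty; ⊤)
open import Data.List using (List; []; _∷_; map)
import Data.List.Membership.Propositional as LM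
open import Data.List.Relation.Unary.All using (All)
open import Data.List.Relation.Unary.AllPairs using (AllPairs)
open import Data.Product using (Σ; ∃; _×_; _,_)
open import Relation.Binary.PropositionalEquality using (_≡_; _≢_)
open import Relation.Nullary using (¬_)

-- A group of pure Horn clauses  B → H  (body B, head set H), V = Fin n.
record Group (n : ℕ) : Set where
  constructor _⇒_
  field
    body : Subset n
    head : Subset n
open Group public

CNF : ℕ → Set
CNF n = List (Group n)

GroupOK : ∀ {n} → Group n → Set
GroupOK (B ⇒ H) = Nonempty B × Nonempty H × Empty (B ∩ H)

WellFormed : ∀ {n} → CNF n → Set
WellFormed Φ = All GroupOK Φ × AllPairs _≢_ (map body Φ)

-- Truth assignments are subsets x of V (the set of true variables).
SatGroup : ∀ {n} → Subset n → Group n → Set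
SatGroup x (B ⇒ H) = B ⊆ x → H ⊆ x

Sat : ∀ {n} → CNF n → Subset n → Set
Sat Φ x = All (SatGroup x) Φ

keyCNF : ∀ {n} → List (Subset n) → CNF n
keyCNF ℬ = map (λ B → B ⇒ ∁ B) ℬ

Represents : ∀ {n} → CNF n → List (Subset n) → Set
Represents Φ ℬ = ∀ x → (Sat Φ x → Sat (keyCNF ℬ) x) × (Sat (keyCNF ℬ) x → Sat Φ x)

-- T ⊆ F_Φ(S), F_Φ(S) being the smallest superset of S satisfying Φ.
InClosure : ∀ {n} → CNF n → Subset n → Subset n → Set
InClosure Φ S T = ∀ x → S ⊆ x → Sat Φ x → T ⊆ x

data Measure : Set where
  mB mBA mTA mC mBC mL : Measure

measure : ∀ {n} → Measure → CNF n → ℕ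
measure μ [] = 0
measure μ ((B ⇒ H) ∷ Φ) = term μ + measure μ Φ
  where
  term : Measure → ℕ
  term mB  = 1
  term mBA = ∣ B ∣
  term mTA = ∣ B ∣ + ∣ H ∣
  term mC  = ∣ H ∣
  term mBC = ∣ H ∣ + 1
  term mL  = (∣ B ∣ + 1) * ∣ H ∣

BodiesIn : ∀ {n} → CNF n → List (Subset n) → Set
BodiesIn Φ ℬ = All (λ g → body g LM.∈ ℬ) Φ

Admissible : ∀ {n} → List (Subset n) → Subset n → Subset n → CNF n → Set
Admissible ℬ S T Φ = WellFormed Φ × BodiesIn Φ ℬ × InClosure Φ S T

IsPrice : ∀ {n} → Measure → List (Subset n) → Subset n → Subset n → ℕ → Set
IsPrice μ ℬ S T k =
  (Σ (CNF _) λ Φ → Admissible ℬ S T Φ × measure μ Φ ≡ k) ×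
  (∀ Φ → Admissible ℬ S T Φ → k ≤ measure μ Φ)

-- Partition of ℬ given by a labelling c : ℬ_i = { B ∈ ℬ | c B ≡ i }.
-- m = min { price_μ(S, B) | B ∈ ℬ ∖ ℬ_i }.
IsMinPrice : ∀ {n q} → Measure → List (Subset n) → (Subset n → Fin q) →
             Fin q → Subset n → ℕ → Set
IsMinPrice μ ℬ c i S m =
  (Σ _ λ B → B LM.∈ ℬ × c B ≢ i × IsPrice μ ℬ S B m) ×
  (∀ B → B LM.∈ ℬ → c B ≢ i → ∀ k → IsPrice μ ℬ S B k → m ≤ k)

Sperner : ∀ {n} → List (Subset n) → Set
Sperner ℬ = ∀ A B → A LM.∈ ℬ → B LM.∈ ℬ → A ⊆ B → A ≡ B

NonemptyProper : ∀ {n} → List (Subset n) → Set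
NonemptyProper ℬ = ∀ B → B LM.∈ ℬ → Nonempty B × B ≢ ⊤

UnionIsV : ∀ {n} → List (Subset n) → Set
UnionIsV {n} ℬ = ∀ (v : Fin n) → Σ _ λ B → B LM.∈ ℬ × v ∈ B

InterEmpty : ∀ {n} → List (Subset n) → Set
InterEmpty {n} ℬ = ∀ (v : Fin n) → Σ _ λ B → B LM.∈ ℬ × v ∉ B

module Submission where

open import Defs
open import Data.Bool using (true; false; if_then_else_)
import Data.Bool.Properties as Bool
open import Data.Empty using (⊥-elim)
open import Data.Fin using (Fin; zero; suc; _≟_; punchIn)
open import Data.Fin.Properties using (punchInᵢ≢i)
open import Data.Fin.Subset using (Subset; _⊆_; ∁; _∩_; _∪_; ∣_∣; Nonempty; Empty) renaming (_∈_ to _∈ₛ_)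
open import Data.Fin.Subset.Properties using (_∈?_; _⊆?_; anySubset?; x∈p∩q⁺; x∈p∩q⁻; x∈p∪q⁺; x∈p∪q⁻; x∉p⇒x∈∁p; p⊆q⇒∣p∣≤∣q∣)
open import Data.List using (List; []; _∷_; map; foldr; filter)
open import Data.List.Membership.Propositional using (_∈_; find; lose)
open import Data.List.Membership.Propositional.Properties using (∈-filter⁺)
open import Data.List.Relation.Unary.All as All using (All; []; _∷_)
open import Data.List.Relation.Unary.All.Properties as All using (¬Any⇒All¬)
open import Data.List.Relation.Unary.AllPairs using (AllPairs; []; _∷_)
open import Data.List.Relation.Unary.Any using (any?)
open import Data.Nat using (ℕ; zero; suc; _≤_; _<_; _+_; _*_; z≤n; s≤s; _≤?_)
open import Data.Nat.Induction using (<-rec)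
open import Data.Nat.Properties
  using (≤-refl; ≤-trans; ≤-reflexive; <⇒≤; ≮⇒≥; n≤1+n; m≤m+n; m≤n+m; +-mono-≤; +-monoˡ-≤; +-monoʳ-≤;
         *-mono-≤; +-assoc; +-suc; +-identityʳ; *-distribˡ-+; +-commutativeSemigroup; module ≤-Reasoning)
open import Algebra.Properties.CommutativeSemigroup +-commutativeSemigroup using (interchange; x∙yz≈y∙xz)
open import Data.Product using (_×_; _,_; proj₁; proj₂; ∃)
open import Data.Sum using (inj₁; inj₂)
open import Data.Vec using ([]; _∷_; sum; tabulate)
open import Data.Vec.Properties using (tabulate-cong; lookup∘tabulate; []=⇒lookup; lookup⇒[]=; ≡-dec)
open import Relation.Binary.Definitions using (DecidableEquality)
open import Relation.Binary.PropositionalEquality using (_≡_; _≢_; refl; sym; trans; cong; cong₂; subst; subst₂; module ≡-Reasoning)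
open import Relation.Nullary using (¬_; Dec; yes; no; does; proof; ¬?)
open import Relation.Nullary.Decidable using (dec-true; decidable-stable; ¬¬-excluded-middle; _×-dec_; _→-dec_)
open import Relation.Nullary.Reflects using (Reflects; invert)
open import Relation.Unary using (Decidable)

-- Replace every clause B' → H of a representation Φ by B → H for some key B ∈ ℬ with B ⊆ B'
-- (one exists, since otherwise B' would be a model of h_ℬ violating the clause).  None of the
-- measures grows, and grouping the new clauses by the block of ℬ containing their body (merging
-- equal bodies) splits Φ into CNFs Φ₁, …, Φ_q of total measure at most that of Φ.  The closure
-- X of B_i under Φ_i contains a key outside ℬ_i: otherwise X would be closed under every clause
-- of Φ, i.e. a model of h_ℬ containing the key B_i, so X = V would contain B_j for j ≠ i.
-- Hence Φ_i is admissible for price(B_i, B) with B ∉ ℬ_i, and its measure is at least m_i.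

groupCost : Measure → ℕ → ℕ → ℕ
groupCost mB  b h = 1
groupCost mBA b h = b
groupCost mTA b h = b + h
groupCost mC  b h = h
groupCost mBC b h = h + 1
groupCost mL  b h = (b + 1) * h

cost : ∀ {n} → Measure → Group n → ℕ
cost μ (B ⇒ H) = groupCost μ (∣ B ∣) (∣ H ∣)

measure-∷ : ∀ {n} μ (g : Group n) Φ → measure μ (g ∷ Φ) ≡ cost μ g + measure μ Φ
measure-∷ mB  g Φ = refl
measure-∷ mBA g Φ = refl
measure-∷ mTA g Φ = refl
measure-∷ mC  g Φ = refl
measure-∷ mBC g Φ = refl
measure-∷ mL  g Φ = refl

measure-∷-mono : ∀ {n} μ (g g′ : Group n) Φ Ψ → cost μ g ≤ cost μ g′ → measure μ Φ ≤ measure μ Ψ →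
  measure μ (g ∷ Φ) ≤ measure μ (g′ ∷ Ψ)
measure-∷-mono μ g g′ Φ Ψ g≤g′ Φ≤Ψ =
  subst₂ _≤_ (sym (measure-∷ μ g Φ)) (sym (measure-∷ μ g′ Ψ)) (+-mono-≤ g≤g′ Φ≤Ψ)

groupCost-mono : ∀ μ {b b′ h h′} → b ≤ b′ → h ≤ h′ → groupCost μ b h ≤ groupCost μ b′ h′
groupCost-mono mB  b≤b′ h≤h′ = ≤-refl
groupCost-mono mBA b≤b′ h≤h′ = b≤b′
groupCost-mono mTA b≤b′ h≤h′ = +-mono-≤ b≤b′ h≤h′
groupCost-mono mC  b≤b′ h≤h′ = h≤h′
groupCost-mono mBC b≤b′ h≤h′ = +-monoˡ-≤ 1 h≤h′
groupCost-mono mL  b≤b′ h≤h′ = *-mono-≤ (+-monoˡ-≤ 1 b≤b′) h≤h′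

groupCost-subadditive : ∀ μ b h h′ → groupCost μ b (h + h′) ≤ groupCost μ b h + groupCost μ b h′
groupCost-subadditive mB  b h h′ = s≤s z≤n
groupCost-subadditive mBA b h h′ = m≤m+n b b
groupCost-subadditive mTA b h h′ =
  ≤-trans (≤-reflexive (sym (+-assoc b h h′))) (+-monoʳ-≤ (b + h) (m≤n+m h′ b))
groupCost-subadditive mC  b h h′ = ≤-refl
groupCost-subadditive mBC b h h′ =
  ≤-trans (≤-reflexive (+-assoc h h′ 1)) (+-monoˡ-≤ (h′ + 1) (m≤m+n h 1))
groupCost-subadditive mL  b h h′ = ≤-reflexive (*-distribˡ-+ (b + 1) h h′)

∣p∪q∣≤∣p∣+∣q∣ : ∀ {n} (p q : Subset n) → ∣ p ∪ q ∣ ≤ ∣ p ∣ + ∣ q ∣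
∣p∪q∣≤∣p∣+∣q∣ []          []          = z≤n
∣p∪q∣≤∣p∣+∣q∣ (true ∷ p)  (true ∷ q)  = s≤s (≤-trans (∣p∪q∣≤∣p∣+∣q∣ p q) (+-monoʳ-≤ ∣ p ∣ (n≤1+n ∣ q ∣)))
∣p∪q∣≤∣p∣+∣q∣ (true ∷ p)  (false ∷ q) = s≤s (∣p∪q∣≤∣p∣+∣q∣ p q)
∣p∪q∣≤∣p∣+∣q∣ (false ∷ p) (true ∷ q)  = ≤-trans (s≤s (∣p∪q∣≤∣p∣+∣q∣ p q)) (≤-reflexive (sym (+-suc ∣ p ∣ ∣ q ∣)))
∣p∪q∣≤∣p∣+∣q∣ (false ∷ p) (false ∷ q) = ∣p∪q∣≤∣p∣+∣q∣ p q

sum-tabulate-mono : ∀ {q} {f g : Fin q → ℕ} → (∀ i → f i ≤ g i) → sum (tabulate f) ≤ sum (tabulate g)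
sum-tabulate-mono {zero}  f≤g = z≤n
sum-tabulate-mono {suc q} f≤g = +-mono-≤ (f≤g zero) (sum-tabulate-mono (λ i → f≤g (suc i)))

sum-tabulate-+ : ∀ {q} (f g : Fin q → ℕ) →
  sum (tabulate (λ i → f i + g i)) ≡ sum (tabulate f) + sum (tabulate g)
sum-tabulate-+ {zero}  f g = refl
sum-tabulate-+ {suc q} f g =
  trans (cong (f zero + g zero +_) (sum-tabulate-+ (λ i → f (suc i)) (λ i → g (suc i))))
        (interchange (f zero) (g zero) _ _)

sum-tabulate-zero : ∀ q → sum (tabulate {n = q} (λ _ → 0)) ≡ 0
sum-tabulate-zero zero    = refl
sum-tabulate-zero (suc q) = sum-tabulate-zero q

sum-tabulate-indicator : ∀ {q} (k : Fin q) x → sum (tabulate (λ i → if does (k ≟ i) then x else 0)) ≡ x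
sum-tabulate-indicator {suc q} zero    x = trans (cong (x +_) (sum-tabulate-zero q)) (+-identityʳ x)
sum-tabulate-indicator {suc q} (suc k) x = sum-tabulate-indicator k x

Fin-other : ∀ {q} → 2 ≤ q → (i : Fin q) → ∃ λ j → j ≢ i
Fin-other (s≤s (s≤s _)) i = punchIn i zero , punchInᵢ≢i i zero

-- The least price exists only classically; as ≤ is decidable, double negation suffices.
bounds-minimum⇒bounds : ∀ (P : ℕ → Set) {m} → (∀ k → P k → (∀ j → P j → k ≤ j) → m ≤ k) →
  ∀ {w} → P w → m ≤ w
bounds-minimum⇒bounds P {m} boundsMinimum {w} = <-rec (λ w → P w → m ≤ w) step w
  where
  step : ∀ w → (∀ {j} → j < w → P j → m ≤ j) → P w → m ≤ w
  step w below Pw = decidable-stable (m ≤? w) λ m≰w → ¬¬-excluded-middle {A = ∃ λ j → j < w × P j} λ where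
    (yes (j , j<w , Pj)) → m≰w (≤-trans (below j<w Pj) (<⇒≤ j<w))
    (no ∄smaller) → m≰w (boundsMinimum w Pw λ j Pj → ≮⇒≥ λ j<w → ∄smaller (j , j<w , Pj))

module _ {n : ℕ} where

  _≟ₛ_ : DecidableEquality (Subset n)
  _≟ₛ_ = ≡-dec Bool._≟_

  ∀-Subset? : {P : Subset n → Set} → (∀ x → Dec (P x)) → Dec (∀ x → P x)
  ∀-Subset? P? with anySubset? (λ x → ¬? (P? x))
  ... | yes (x , ¬Px) = no λ ∀P → ¬Px (∀P x)
  ... | no ∄¬P        = yes λ x → decidable-stable (P? x) λ ¬Px → ∄¬P (x , ¬Px)

  Sat? : (Ψ : CNF n) (x : Subset n) → Dec (Sat Ψ x)
  Sat? Ψ x = All.all? (λ g → body g ⊆? x →-dec head g ⊆? x) Ψ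

  ∈-tabulate-does⁺ : {P : Fin n → Set} (P? : Decidable P) {v : Fin n} →
    P v → v ∈ₛ tabulate (λ u → does (P? u))
  ∈-tabulate-does⁺ P? {v} Pv = lookup⇒[]= v _ (trans (lookup∘tabulate _ v) (dec-true (P? v) Pv))

  ∈-tabulate-does⁻ : {P : Fin n → Set} (P? : Decidable P) {v : Fin n} →
    v ∈ₛ tabulate (λ u → does (P? u)) → P v
  ∈-tabulate-does⁻ {P} P? {v} v∈ =
    invert (subst (Reflects (P v)) (trans (sym (lookup∘tabulate _ v)) ([]=⇒lookup v∈)) (proof (P? v)))

  -- The intersection of all models of Ψ containing S: models of Horn CNFs are closed under
  -- intersection, so this is the forward-chaining closure F_Ψ(S).
  closure : CNF n → Subset n → Subset n
  closure Ψ S = tabulate λ v → does (∀-Subset? λ x → S ⊆? x →-dec Sat? Ψ x →-dec v ∈? x)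

  module _ (Ψ : CNF n) (S : Subset n) where

    closure-least : ∀ x → S ⊆ x → Sat Ψ x → closure Ψ S ⊆ x
    closure-least x S⊆x x⊨Ψ v∈ = ∈-tabulate-does⁻ (λ _ → ∀-Subset? _) v∈ x S⊆x x⊨Ψ

    ⊆-closure : S ⊆ closure Ψ S
    ⊆-closure v∈S = ∈-tabulate-does⁺ (λ _ → ∀-Subset? _) λ x S⊆x _ → S⊆x v∈S

    closure-sat : Sat Ψ (closure Ψ S)
    closure-sat = All.tabulate λ {g} g∈Ψ B⊆X v∈H → ∈-tabulate-does⁺ (λ _ → ∀-Subset? _) λ x S⊆x x⊨Ψ →
      All.lookup x⊨Ψ g∈Ψ (λ u∈B → closure-least x S⊆x x⊨Ψ (B⊆X u∈B)) v∈H

    ⊆-closure⇒InClosure : ∀ {T} → T ⊆ closure Ψ S → InClosure Ψ S T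
    ⊆-closure⇒InClosure T⊆X x S⊆x x⊨Ψ v∈T = closure-least x S⊆x x⊨Ψ (T⊆X v∈T)

  insert : Group n → CNF n → CNF n
  insert g []        = g ∷ []
  insert g (g′ ∷ Ψ) with body g ≟ₛ body g′
  ... | yes _ = (body g′ ⇒ (head g ∪ head g′)) ∷ Ψ
  ... | no _  = g′ ∷ insert g Ψ

  merge : CNF n → CNF n
  merge = foldr insert []

  insert-sat : ∀ g Ψ {x} → Sat (insert g Ψ) x → Sat (g ∷ Ψ) x
  insert-sat g []        s = s
  insert-sat g (g′ ∷ Ψ) s with body g ≟ₛ body g′
  insert-sat g (g′ ∷ Ψ) (s ∷ ss) | yes refl =
    (λ B⊆x v∈ → s B⊆x (x∈p∪q⁺ (inj₁ v∈))) ∷ (λ B⊆x v∈ → s B⊆x (x∈p∪q⁺ (inj₂ v∈))) ∷ ss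
  insert-sat g (g′ ∷ Ψ) (s ∷ ss) | no _ with insert-sat g Ψ ss
  ... | t ∷ ts = t ∷ s ∷ ts

  merge-sat : ∀ Ψ {x} → Sat (merge Ψ) x → Sat Ψ x
  merge-sat []      s = s
  merge-sat (g ∷ Ψ) s with insert-sat g (merge Ψ) s
  ... | t ∷ ts = t ∷ merge-sat Ψ ts

  insert-bodies : ∀ {P : Subset n → Set} g Ψ → P (body g) →
    All (λ g′ → P (body g′)) Ψ → All (λ g′ → P (body g′)) (insert g Ψ)
  insert-bodies g []        p ps = p ∷ []
  insert-bodies g (g′ ∷ Ψ) p ps with body g ≟ₛ body g′
  insert-bodies g (g′ ∷ Ψ) p (p′ ∷ ps) | yes _ = p′ ∷ ps
  insert-bodies g (g′ ∷ Ψ) p (p′ ∷ ps) | no _  = p′ ∷ insert-bodies g Ψ p ps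

  merge-bodies : ∀ {P : Subset n → Set} Ψ → All (λ g → P (body g)) Ψ → All (λ g → P (body g)) (merge Ψ)
  merge-bodies []      []       = []
  merge-bodies (g ∷ Ψ) (p ∷ ps) = insert-bodies g (merge Ψ) p (merge-bodies Ψ ps)

  insert-distinct : ∀ g Ψ → AllPairs _≢_ (map body Ψ) → AllPairs _≢_ (map body (insert g Ψ))
  insert-distinct g []        ds = [] ∷ []
  insert-distinct g (g′ ∷ Ψ) ds with body g ≟ₛ body g′
  insert-distinct g (g′ ∷ Ψ) ds       | yes _ = ds
  insert-distinct g (g′ ∷ Ψ) (d ∷ ds) | no g≢g′ =
    All.map⁺ (insert-bodies g Ψ (λ eq → g≢g′ (sym eq)) (All.map⁻ d)) ∷ insert-distinct g Ψ ds

  merge-distinct : ∀ Ψ → AllPairs _≢_ (map body (merge Ψ))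
  merge-distinct []      = []
  merge-distinct (g ∷ Ψ) = insert-distinct g (merge Ψ) (merge-distinct Ψ)

  disjoint-∪ : ∀ {p q r : Subset n} → Empty (p ∩ q) → Empty (p ∩ r) → Empty (p ∩ (q ∪ r))
  disjoint-∪ {p} {q} {r} p∩q=∅ p∩r=∅ (v , v∈) with x∈p∩q⁻ p (q ∪ r) v∈
  ... | v∈p , v∈q∪r with x∈p∪q⁻ q r v∈q∪r
  ...   | inj₁ v∈q = p∩q=∅ (v , x∈p∩q⁺ (v∈p , v∈q))
  ...   | inj₂ v∈r = p∩r=∅ (v , x∈p∩q⁺ (v∈p , v∈r))

  insert-ok : ∀ g Ψ → GroupOK g → All GroupOK Ψ → All GroupOK (insert g Ψ)
  insert-ok g []        ok oks = ok ∷ []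
  insert-ok g (g′ ∷ Ψ) ok oks with body g ≟ₛ body g′
  insert-ok g (g′ ∷ Ψ) (_ , (v , v∈H) , B∩H=∅) ((B≠∅ , _ , B∩H′=∅) ∷ oks) | yes refl =
    (B≠∅ , (v , x∈p∪q⁺ (inj₁ v∈H)) , disjoint-∪ B∩H=∅ B∩H′=∅) ∷ oks
  insert-ok g (g′ ∷ Ψ) ok (ok′ ∷ oks) | no _ = ok′ ∷ insert-ok g Ψ ok oks

  merge-wellFormed : ∀ Ψ → All GroupOK Ψ → WellFormed (merge Ψ)
  merge-wellFormed Ψ oks = okMerge Ψ oks , merge-distinct Ψ
    where
    okMerge : ∀ Ψ → All GroupOK Ψ → All GroupOK (merge Ψ)
    okMerge []      []         = []
    okMerge (g ∷ Ψ) (ok ∷ oks) = insert-ok g (merge Ψ) ok (okMerge Ψ oks)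

  insert-measure : ∀ μ g Ψ → measure μ (insert g Ψ) ≤ measure μ (g ∷ Ψ)
  insert-measure μ g []        = ≤-refl
  insert-measure μ g (g′ ∷ Ψ) with body g ≟ₛ body g′
  insert-measure μ (B ⇒ H) ((.B ⇒ H′) ∷ Ψ) | yes refl = begin
    measure μ ((B ⇒ (H ∪ H′)) ∷ Ψ)                    ≡⟨ measure-∷ μ (B ⇒ (H ∪ H′)) Ψ ⟩
    cost μ (B ⇒ (H ∪ H′)) + measure μ Ψ               ≤⟨ +-monoˡ-≤ (measure μ Ψ) cost-∪ ⟩
    cost μ (B ⇒ H) + cost μ (B ⇒ H′) + measure μ Ψ    ≡⟨ +-assoc (cost μ (B ⇒ H)) (cost μ (B ⇒ H′)) (measure μ Ψ) ⟩
    cost μ (B ⇒ H) + (cost μ (B ⇒ H′) + measure μ Ψ)  ≡⟨ cong (cost μ (B ⇒ H) +_) (measure-∷ μ (B ⇒ H′) Ψ) ⟨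
    cost μ (B ⇒ H) + measure μ ((B ⇒ H′) ∷ Ψ)         ≡⟨ measure-∷ μ (B ⇒ H) ((B ⇒ H′) ∷ Ψ) ⟨
    measure μ ((B ⇒ H) ∷ (B ⇒ H′) ∷ Ψ)                ∎
    where
    open ≤-Reasoning
    cost-∪ : cost μ (B ⇒ (H ∪ H′)) ≤ cost μ (B ⇒ H) + cost μ (B ⇒ H′)
    cost-∪ = ≤-trans (groupCost-mono μ ≤-refl (∣p∪q∣≤∣p∣+∣q∣ H H′)) (groupCost-subadditive μ _ _ _)
  insert-measure μ g (g′ ∷ Ψ) | no _ = begin
    measure μ (g′ ∷ insert g Ψ)                 ≡⟨ measure-∷ μ g′ (insert g Ψ) ⟩
    cost μ g′ + measure μ (insert g Ψ)          ≤⟨ +-monoʳ-≤ (cost μ g′) (insert-measure μ g Ψ) ⟩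
    cost μ g′ + measure μ (g ∷ Ψ)               ≡⟨ cong (cost μ g′ +_) (measure-∷ μ g Ψ) ⟩
    cost μ g′ + (cost μ g + measure μ Ψ)        ≡⟨ x∙yz≈y∙xz (cost μ g′) (cost μ g) (measure μ Ψ) ⟩
    cost μ g + (cost μ g′ + measure μ Ψ)        ≡⟨ cong (cost μ g +_) (measure-∷ μ g′ Ψ) ⟨
    cost μ g + measure μ (g′ ∷ Ψ)               ≡⟨ measure-∷ μ g (g′ ∷ Ψ) ⟨
    measure μ (g ∷ g′ ∷ Ψ)                      ∎
    where open ≤-Reasoning

  merge-measure : ∀ μ Ψ → measure μ (merge Ψ) ≤ measure μ Ψ
  merge-measure μ []      = ≤-refl
  merge-measure μ (g ∷ Ψ) =
    ≤-trans (insert-measure μ g (merge Ψ)) (measure-∷-mono μ g g (merge Ψ) Ψ ≤-refl (merge-measure μ Ψ))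

  Sat-filter⁻ : ∀ {P : Group n → Set} (P? : Decidable P) {Ψ x} → Sat (filter P? Ψ) x →
    (∀ {g} → g ∈ Ψ → body g ⊆ x → P g) → Sat Ψ x
  Sat-filter⁻ P? x⊨filter relevant =
    All.tabulate λ g∈Ψ B⊆x → All.lookup x⊨filter (∈-filter⁺ P? g∈Ψ (relevant g∈Ψ B⊆x)) B⊆x

measure-filter-∷ : ∀ {n} μ {P : Group n → Set} (P? : Decidable P) g Ψ →
  measure μ (filter P? (g ∷ Ψ)) ≡ (if does (P? g) then cost μ g else 0) + measure μ (filter P? Ψ)
measure-filter-∷ μ P? g Ψ with does (P? g)
... | true  = measure-∷ μ g (filter P? Ψ)
... | false = refl

module _ {n q : ℕ} (f : Group n → Fin q) where

  block : Fin q → CNF n → CNF n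
  block i = filter (λ g → f g ≟ i)

  measure-blocks : ∀ μ Ψ → sum (tabulate λ i → measure μ (block i Ψ)) ≡ measure μ Ψ
  measure-blocks μ []      = sum-tabulate-zero q
  measure-blocks μ (g ∷ Ψ) = begin
    sum (tabulate λ i → measure μ (block i (g ∷ Ψ)))
      ≡⟨ cong sum (tabulate-cong λ i → measure-filter-∷ μ (λ g → f g ≟ i) g Ψ) ⟩
    sum (tabulate λ i → indicator i + measure μ (block i Ψ))
      ≡⟨ sum-tabulate-+ indicator (λ i → measure μ (block i Ψ)) ⟩
    sum (tabulate indicator) + sum (tabulate λ i → measure μ (block i Ψ))
      ≡⟨ cong₂ _+_ (sum-tabulate-indicator (f g) (cost μ g)) (measure-blocks μ Ψ) ⟩
    cost μ g + measure μ Ψ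
      ≡⟨ measure-∷ μ g Ψ ⟨
    measure μ (g ∷ Ψ) ∎
    where
    open ≡-Reasoning
    indicator : Fin q → ℕ
    indicator i = if does (f g ≟ i) then cost μ g else 0

GroupOK⇒head⊈body : ∀ {n} {g : Group n} → GroupOK g → ¬ head g ⊆ body g
GroupOK⇒head⊈body (_ , (v , v∈H) , B∩H=∅) H⊆B = B∩H=∅ (v , x∈p∩q⁺ (H⊆B v∈H , v∈H))

module _ {n : ℕ} (ℬ : List (Subset n)) where

  KeyBelow : Group n → Set
  KeyBelow g = ∃ λ B → B ∈ ℬ × B ⊆ body g

  keyFree⇒Sat-keyCNF : ∀ {x} → All (λ B → ¬ B ⊆ x) ℬ → Sat (keyCNF ℬ) x
  keyFree⇒Sat-keyCNF {x} keyFree = All.map⁺ (All.map vacuous keyFree)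
    where
    vacuous : ∀ {B} → ¬ B ⊆ x → SatGroup x (B ⇒ ∁ B)
    vacuous B⊈x B⊆x = ⊥-elim (B⊈x B⊆x)

  Sat-keyCNF⇒full : ∀ {x B} → Sat (keyCNF ℬ) x → B ∈ ℬ → B ⊆ x → ∀ v → v ∈ₛ x
  Sat-keyCNF⇒full {B = B} x⊨key B∈ℬ B⊆x v with v ∈? B
  ... | yes v∈B = B⊆x v∈B
  ... | no  v∉B = All.lookup (All.map⁻ x⊨key) B∈ℬ B⊆x (x∉p⇒x∈∁p v∉B)

  representation-keyBelow : ∀ {Φ} → All GroupOK Φ → Represents Φ ℬ → All KeyBelow Φ
  representation-keyBelow {Φ} oks rep = All.tabulate keyBelow
    where
    keyBelow : ∀ {g} → g ∈ Φ → KeyBelow g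
    keyBelow {g} g∈Φ with any? (_⊆? body g) ℬ
    ... | yes key = find key
    ... | no  ∄key = ⊥-elim (GroupOK⇒head⊈body (All.lookup oks g∈Φ) (All.lookup B⊨Φ g∈Φ (λ u∈B → u∈B)))
      where
      B⊨Φ : Sat Φ (body g)
      B⊨Φ = proj₂ (rep (body g)) (keyFree⇒Sat-keyCNF (¬Any⇒All¬ ℬ ∄key))

  reassign : ∀ {Φ} → All KeyBelow Φ → CNF n
  reassign []                             = []
  reassign {Φ = g ∷ _} ((B , _) ∷ keys) = (B ⇒ head g) ∷ reassign keys

  reassign-measure : ∀ μ {Φ} (keys : All KeyBelow Φ) → measure μ (reassign keys) ≤ measure μ Φ
  reassign-measure μ [] = ≤-refl
  reassign-measure μ {g ∷ Φ} ((B , _ , B⊆) ∷ keys) = measure-∷-mono μ (B ⇒ head g) g (reassign keys) Φ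
    (groupCost-mono μ (p⊆q⇒∣p∣≤∣q∣ B⊆) ≤-refl) (reassign-measure μ keys)

  reassign-bodies : ∀ {Φ} (keys : All KeyBelow Φ) → BodiesIn (reassign keys) ℬ
  reassign-bodies []                     = []
  reassign-bodies ((_ , B∈ℬ , _) ∷ keys) = B∈ℬ ∷ reassign-bodies keys

  reassign-ok : (∀ B → B ∈ ℬ → Nonempty B) → ∀ {Φ} (keys : All KeyBelow Φ) → All GroupOK Φ →
    All GroupOK (reassign keys)
  reassign-ok keysNonempty [] [] = []
  reassign-ok keysNonempty ((B , B∈ℬ , B⊆B′) ∷ keys) ((_ , H≠∅ , B′∩H=∅) ∷ oks) =
    (keysNonempty B B∈ℬ , H≠∅ , B∩H=∅) ∷ reassign-ok keysNonempty keys oks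
    where
    B∩H=∅ : Empty (B ∩ _)
    B∩H=∅ (v , v∈) with x∈p∩q⁻ B _ v∈
    ... | v∈B , v∈H = B′∩H=∅ (v , x∈p∩q⁺ (B⊆B′ v∈B , v∈H))

  reassign-sat : ∀ {Φ x} (keys : All KeyBelow Φ) → Sat (reassign keys) x → Sat Φ x
  reassign-sat []                    []       = []
  reassign-sat ((_ , _ , B⊆) ∷ keys) (s ∷ ss) = (λ B′⊆x → s (λ v∈B → B′⊆x (B⊆ v∈B))) ∷ reassign-sat keys ss

module _ {n q : ℕ} (ℬ : List (Subset n)) (c : Subset n → Fin q) where

  blockOf : Group n → Fin q
  blockOf g = c (body g)

  part : Fin q → CNF n → CNF n
  part i Ψ = merge (block blockOf i Ψ)

  measure-parts : ∀ μ Ψ → sum (tabulate λ i → measure μ (part i Ψ)) ≤ measure μ Ψ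
  measure-parts μ Ψ = begin
    sum (tabulate λ i → measure μ (part i Ψ))           ≤⟨ sum-tabulate-mono (λ i → merge-measure μ (block blockOf i Ψ)) ⟩
    sum (tabulate λ i → measure μ (block blockOf i Ψ))  ≡⟨ measure-blocks blockOf μ Ψ ⟩
    measure μ Ψ                                         ∎
    where open ≤-Reasoning

  IsMinPrice⇒≤ : ∀ {μ i S m T Φ} → IsMinPrice μ ℬ c i S m → T ∈ ℬ → c T ≢ i → Admissible ℬ S T Φ →
    m ≤ measure μ Φ
  IsMinPrice⇒≤ {μ} {S = S} {T = T} (_ , minimal) T∈ℬ cT≢i adm = bounds-minimum⇒bounds Attained
    (λ k attained least → minimal T T∈ℬ cT≢i k (attained , λ Ψ adm′ → least _ (Ψ , adm′ , refl)))
    (_ , adm , refl)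
    where
    Attained : ℕ → Set
    Attained k = ∃ λ Ψ → Admissible ℬ S T Ψ × measure μ Ψ ≡ k

  foreignKey-⊆ : ∀ {Ψ} → BodiesIn Ψ ℬ → (∀ x → Sat Ψ x → Sat (keyCNF ℬ) x) →
    ∀ {i S T₀ x} → S ∈ ℬ → T₀ ∈ ℬ → c T₀ ≢ i → S ⊆ x → Sat (part i Ψ) x →
    ∃ λ T → T ∈ ℬ × c T ≢ i × T ⊆ x
  foreignKey-⊆ {Ψ} bodies implies {i} {x = x} S∈ℬ T₀∈ℬ cT₀≢i S⊆x x⊨part
    with any? (λ T → ¬? (c T ≟ i) ×-dec T ⊆? x) ℬ
  ... | yes found = find found
  ... | no  none  = ⊥-elim (cT₀≢i (inBlock T₀∈ℬ (λ {v} _ → x-full v)))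
    where
    inBlock : ∀ {T} → T ∈ ℬ → T ⊆ x → c T ≡ i
    inBlock {T} T∈ℬ T⊆x = decidable-stable (c T ≟ i) λ cT≢i → none (lose T∈ℬ (cT≢i , T⊆x))
    x⊨Ψ : Sat Ψ x
    x⊨Ψ = Sat-filter⁻ (λ g → blockOf g ≟ i) (merge-sat _ x⊨part)
      (λ g∈Ψ B⊆x → inBlock (All.lookup bodies g∈Ψ) B⊆x)
    x-full : ∀ v → v ∈ₛ x
    x-full = Sat-keyCNF⇒full ℬ (implies x x⊨Ψ) S∈ℬ S⊆x

  minPrice≤part : ∀ {μ Ψ} → All GroupOK Ψ → BodiesIn Ψ ℬ → (∀ x → Sat Ψ x → Sat (keyCNF ℬ) x) →
    ∀ {i S T₀ m} → S ∈ ℬ → T₀ ∈ ℬ → c T₀ ≢ i → IsMinPrice μ ℬ c i S m → m ≤ measure μ (part i Ψ)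
  minPrice≤part {Ψ = Ψ} oks bodies implies {i} {S} S∈ℬ T₀∈ℬ cT₀≢i minPrice
    with foreignKey-⊆ bodies implies S∈ℬ T₀∈ℬ cT₀≢i (⊆-closure (part i Ψ) S) (closure-sat (part i Ψ) S)
  ... | T , T∈ℬ , cT≢i , T⊆X = IsMinPrice⇒≤ minPrice T∈ℬ cT≢i
    (merge-wellFormed _ (All.filter⁺ _ oks) , merge-bodies _ (All.filter⁺ _ bodies) ,
     ⊆-closure⇒InClosure (part i Ψ) S T⊆X)

lemma3 : ∀ {n q} (ℬ : List (Subset n)) (c : Subset n → Fin q) (Bs : Fin q → Subset n) →
    2 ≤ q → Sperner ℬ → NonemptyProper ℬ → UnionIsV ℬ → InterEmpty ℬ →
    (∀ i → Bs i ∈ ℬ × c (Bs i) ≡ i) →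
    (μ : Measure) (m : Fin q → ℕ) → (∀ i → IsMinPrice μ ℬ c i (Bs i) (m i)) →
    (Φ : CNF n) → WellFormed Φ → Represents Φ ℬ →
    sum (tabulate m) ≤ measure μ Φ
lemma3 {n} ℬ c Bs 2≤q _ nonemptyProper _ _ Bs-block μ m minPrice Φ (oks , _) rep = begin
  sum (tabulate m)                                ≤⟨ sum-tabulate-mono bound ⟩
  sum (tabulate λ i → measure μ (part ℬ c i Ψ))   ≤⟨ measure-parts ℬ c μ Ψ ⟩
  measure μ Ψ                                     ≤⟨ reassign-measure ℬ μ keys ⟩
  measure μ Φ                                     ∎
  where
  open ≤-Reasoning
  keys : All (KeyBelow ℬ) Φ
  keys = representation-keyBelow ℬ oks rep
  Ψ : CNF n
  Ψ = reassign ℬ keys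
  bound : ∀ i → m i ≤ measure μ (part ℬ c i Ψ)
  bound i with Fin-other 2≤q i
  ... | j , j≢i = minPrice≤part ℬ c
    (reassign-ok ℬ (λ B B∈ℬ → proj₁ (nonemptyProper B B∈ℬ)) keys oks) (reassign-bodies ℬ keys)
    (λ x x⊨Ψ → proj₁ (rep x) (reassign-sat ℬ keys x⊨Ψ))
    (proj₁ (Bs-block i)) (proj₁ (Bs-block j)) (λ cBⱼ≡i → j≢i (trans (sym (proj₂ (Bs-block j))) cBⱼ≡i))
    (minPrice i)
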